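{- Let $n,s,k,t$ be positive integers. Let $\mathcal{C}\subset 2^{[N]}$ be a simplicial complex such that every inclusion-maximal set of $\mathcal{C}$ has size at least $n$, let $T\subset[N]$ be a set of size $t$ and $F\subset[N]$ a set of size $s$. Then $$|\mathcal{C}^{(k)}(T,F\cup T)|\ge \Big(1-\frac{k-t}{n-s-t}\Big)^s|\mathcal{C}^{(k)}(T)|.$$
   Context: A simplicial complex $\mathcal{C}\subset 2^{[N]}$ is a family such that $A\in\mathcal{C}$ and $B\subset A$ imply $B\in\mathcal{C}$. $\mathcal{C}^{(k)}$ denotes the subfamily of all $k$-element sets of $\mathcal{C}$. For a family $\mathcal{A}$ and sets $X\subset Y$: $\mathcal{A}(X)=\{A\setminus X: A\in\mathcal{A}, X\subset A\}$ and $\mathcal{A}(X,Y)=\{A\setminus X: A\in\mathcal{A}, A\cap Y=X\}$. -}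

module Defs where

open import Data.Nat using (ℕ; zero; suc; _≡ᵇ_)
open import Data.Bool using (Bool; true; false; _∧_)
open import Data.List using (List; []; _∷_; map; _++_; filterᵇ; length)
open import Data.Bool.ListAction using (any)
open import Data.Vec using (_∷_; [])
open import Data.Vec.Properties using (≡-dec)
open import Data.Fin.Subset using (Subset; _⊆_; _∪_; _─_; ∣_∣; inside; outside)
open import Data.Fin.Subset.Properties using (_⊆?_)
open import Relation.Binary.PropositionalEquality using (_≡_)
open import Relation.Nullary.Decidable using (⌊_⌋)
import Data.Bool as B

Family : ℕ → Set
Family N = Subset N → Bool

_∈ᶠ_ : ∀ {N} → Subset N → Family N → Set
A ∈ᶠ 𝒜 = 𝒜 A ≡ true

allSubsets : (N : ℕ) → List (Subset N)
allSubsets zero = [] ∷ []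
allSubsets (suc N) = map (outside ∷_) (allSubsets N) ++ map (inside ∷_) (allSubsets N)

card : ∀ {N} → Family N → ℕ
card {N} 𝒜 = length (filterᵇ 𝒜 (allSubsets N))

_==ˢ_ : ∀ {N} → Subset N → Subset N → Bool
A ==ˢ B = ⌊ ≡-dec B._≟_ A B ⌋

IsSimplicialComplex : ∀ {N} → Family N → Set
IsSimplicialComplex {N} 𝒞 = ∀ (A B : Subset N) → A ∈ᶠ 𝒞 → B ⊆ A → B ∈ᶠ 𝒞

IsMaximal : ∀ {N} → Family N → Subset N → Set
IsMaximal {N} 𝒞 A = A ∈ᶠ 𝒞 × (∀ (B : Subset N) → B ∈ᶠ 𝒞 → A ⊆ B → B ≡ A)
  where open import Data.Product using (_×_)

level : ∀ {N} → ℕ → Family N → Family N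
level k 𝒜 A = 𝒜 A ∧ (∣ A ∣ ≡ᵇ k)

-- 𝒜(X) = { A ∖ X : A ∈ 𝒜, X ⊆ A }
link : ∀ {N} → Family N → Subset N → Family N
link {N} 𝒜 X B = any (λ A → 𝒜 A ∧ ⌊ X ⊆? A ⌋ ∧ ((A ─ X) ==ˢ B)) (allSubsets N)

-- 𝒜(X, Y) = { A ∖ X : A ∈ 𝒜, A ∩ Y = X }
link₂ : ∀ {N} → Family N → Subset N → Subset N → Family N
link₂ {N} 𝒜 X Y B = any (λ A → 𝒜 A ∧ ((A ∩ Y) ==ˢ X) ∧ ((A ─ X) ==ˢ B)) (allSubsets N)
  where open import Data.Fin.Subset using (_∩_)

{-# OPTIONS --safe #-}

-- Write c(G) for the number of k-sets of 𝒞 that contain T and avoid G. Then |𝒞^(k)(T)| ≤ c(∅) and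
-- c(F ∖ T) ≤ |𝒞^(k)(T, F ∪ T)|, so it suffices to show (n − s − k) c(G − x) ≤ (n − s − t) c(G) for
-- x ∈ G ∖ T with |G| ≤ s, and then to remove the points of F ∖ T one at a time.
-- Among the sets counted by c(G − x), those avoiding x are counted by c(G). A set A containing x lies
-- in a maximal face M with |M| ≥ n, and for each of the at least n − k − |G| points y ∈ M ∖ (A ∪ G)
-- the exchange A − x + y is again a k-face through T avoiding G and x. Conversely a face A′ avoiding x
-- arises from at most k − t pairs (A, y), since y ∈ A′ ∖ T and A = A′ − y + x. Double counting these
-- pairs gives (n − k − |G|)·#{A ∋ x} ≤ (k − t)·#{A ∌ x}, which rearranges to the claim.
-- If t > k the left-hand side is 0.
module Submission where

open import Defs
open import Data.Bool as Bool using (true; T)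
open import Data.Bool.Properties using (T-∧)
open import Data.Fin using (Fin; zero; suc; _≟_)
open import Data.Fin.Properties using (any?)
open import Data.Fin.Subset
  using (Subset; ∣_∣; _∪_; _∩_; _─_; _-_; ∁; ⁅_⁆; ⊥; _∈_; _∉_; _⊆_; _⊂_; _⊃_; inside; outside)
open import Data.Fin.Subset.Induction using (⊃-wellFounded)
open import Data.Fin.Subset.Properties
  using (_∈?_; _⊆?_; anySubset?; nonempty?; Empty-unique; ⊆-refl; ⊆-trans; ⊆-antisym; drop-there; ∉⊥;
         x∈∁p⇒x∉p; x∉p⇒x∈∁p; p⊆q⇒∣p∣≤∣q∣; ∣p─q∣≤∣p∣; ∣p∩q∣≤∣q∣; p─q⊆p; p─⊥≡p; ∪-identityʳ; p∩q⊆q;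
         x∈p∩q⁺; x∈p∩q⁻; x∈p∪q⁺; x∈p∪q⁻; x∈p∧x∉q⇒x∈p─q; x∈p∧x≢y⇒x∈p-y; x∈⁅x⁆; x∈⁅y⁆⇒x≡y; x∉⁅y⁆⇒x≢y)
open import Data.List using (List; []; _∷_; _++_; map; length; filter; cartesianProduct; allFin; tabulate)
open import Data.List.Membership.Propositional using (lose) renaming (_∈_ to _∈ₗ_)
open import Data.List.Membership.Propositional.Properties
  using (∈-∃++; ∈-++⁻; ∈-++⁺ˡ; ∈-++⁺ʳ; ∈-filter⁺; ∈-filter⁻; ∈-map⁺; ∈-map⁻; ∈-cartesianProduct⁺; ∈-allFin)
open import Data.List.Properties
  using (length-++; filter-++; filter-≐; filter-none; filter-accept; filter-reject; map-tabulate)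
open import Data.List.Relation.Unary.All as All using ()
open import Data.List.Relation.Unary.AllPairs using ([]; _∷_)
open import Data.List.Relation.Unary.Any using (here; there; satisfied)
open import Data.List.Relation.Unary.Any.Properties using (any⁺; any⁻)
open import Data.List.Relation.Unary.Unique.Propositional using (Unique)
open import Data.List.Relation.Unary.Unique.Propositional.Properties
  using (filter⁺; map⁺; ++⁺; cartesianProduct⁺; allFin⁺)
open import Data.Nat using (ℕ; zero; suc; _≤_; _<_; _+_; _*_; _∸_; _^_; z≤n; s≤s; s≤s⁻¹; _≤?_)
open import Data.Nat.Properties hiding (_≟_)
open import Algebra.Properties.CommutativeSemigroup *-commutativeSemigroup using (x∙yz≈y∙xz)
open import Data.Product using (_×_; _,_; proj₁; proj₂; ∃-syntax)
open import Data.Sum using (_⊎_; inj₁; inj₂)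
open import Data.Vec using ([]; _∷_; here; there)
open import Data.Vec.Properties using (∷-injectiveʳ; ≡-dec)
open import Function using (_∘_)
open import Function.Bundles using (Equivalence)
open import Induction.WellFounded using (Acc; acc)
open import Level using (0ℓ)
open import Relation.Binary.PropositionalEquality
open import Relation.Nullary using (¬_; Dec; yes; no; contradiction; _×-dec_; T?)
open import Relation.Nullary.Decidable using (toWitness; fromWitness; decidable-stable; ¬?)
open import Relation.Unary using (Pred; Decidable; _≐_) renaming (_⊆_ to _⇒_)
open import Relation.Unary.Properties using (_∩?_; ∁?)

count : {A : Set} {P : Pred A 0ℓ} → Decidable P → List A → ℕ
count P? xs = length (filter P? xs)

module _ {A : Set} {P Q : Pred A 0ℓ} (P? : Decidable P) (Q? : Decidable Q) where

  count-mono : P ⇒ Q → ∀ xs → count P? xs ≤ count Q? xs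
  count-mono P⇒Q [] = z≤n
  count-mono P⇒Q (x ∷ xs) with P? x | Q? x
  ... | yes _  | yes _  = s≤s (count-mono P⇒Q xs)
  ... | yes px | no ¬qx = contradiction (P⇒Q px) ¬qx
  ... | no _   | yes _  = m≤n⇒m≤1+n (count-mono P⇒Q xs)
  ... | no _   | no _   = count-mono P⇒Q xs

  count-cong : P ≐ Q → ∀ xs → count P? xs ≡ count Q? xs
  count-cong P≐Q xs = cong length (filter-≐ P? Q? P≐Q xs)

module _ {A : Set} {P : Pred A 0ℓ} (P? : Decidable P) where

  count-accept : ∀ {x} xs → P x → count P? (x ∷ xs) ≡ suc (count P? xs)
  count-accept xs px = cong length (filter-accept P? {xs = xs} px)

  count-reject : ∀ {x} xs → ¬ P x → count P? (x ∷ xs) ≡ count P? xs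
  count-reject xs ¬px = cong length (filter-reject P? {xs = xs} ¬px)

  count-none : ∀ xs → (∀ x → ¬ P x) → count P? xs ≡ 0
  count-none xs ¬P = cong length (filter-none P? (All.universal ¬P xs))

  count-++ : ∀ xs ys → count P? (xs ++ ys) ≡ count P? xs + count P? ys
  count-++ xs ys = trans (cong length (filter-++ P? xs ys)) (length-++ (filter P? xs))

  count-split : {Q : Pred A 0ℓ} (Q? : Decidable Q) →
    ∀ xs → count P? xs ≡ count (P? ∩? Q?) xs + count (P? ∩? ∁? Q?) xs
  count-split Q? [] = refl
  count-split Q? (x ∷ xs) with P? x | Q? x
  ... | yes _ | yes _ = cong suc (count-split Q? xs)
  ... | yes _ | no _  = trans (cong suc (count-split Q? xs)) (sym (+-suc _ _))
  ... | no _  | _     = count-split Q? xs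

count-map : {A B : Set} {P : Pred B 0ℓ} (P? : Decidable P) (f : A → B) →
  ∀ xs → count P? (map f xs) ≡ count (P? ∘ f) xs
count-map P? f [] = refl
count-map P? f (x ∷ xs) with P? (f x)
... | yes _ = cong suc (count-map P? f xs)
... | no _  = count-map P? f xs

length-≤-injection : {A B : Set} (f : A → B) {xs : List A} {ys : List B} → Unique xs →
  (∀ {a a′} → a ∈ₗ xs → a′ ∈ₗ xs → f a ≡ f a′ → a ≡ a′) →
  (∀ {a} → a ∈ₗ xs → f a ∈ₗ ys) → length xs ≤ length ys
length-≤-injection f {[]} _ _ _ = z≤n
length-≤-injection f {x ∷ xs} (x∉xs ∷ unique) injective into
  with us , vs , refl ← ∈-∃++ (into (here refl)) = begin
    suc (length xs)          ≤⟨ s≤s (length-≤-injection f unique (λ p q → injective (there p) (there q)) into′) ⟩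
    suc (length (us ++ vs))  ≡⟨ cong suc (length-++ us) ⟩
    suc (length us + length vs) ≡⟨ +-suc (length us) (length vs) ⟨
    length us + length (f x ∷ vs) ≡⟨ length-++ us ⟨
    length (us ++ f x ∷ vs)  ∎
  where
  open ≤-Reasoning
  into′ : ∀ {a} → a ∈ₗ xs → f a ∈ₗ us ++ vs
  into′ a∈xs with ∈-++⁻ us (into (there a∈xs))
  ... | inj₁ ∈us         = ∈-++⁺ˡ ∈us
  ... | inj₂ (here fa≡fx) = contradiction (sym (injective (there a∈xs) (here refl) fa≡fx)) (All.lookup x∉xs a∈xs)
  ... | inj₂ (there ∈vs) = ∈-++⁺ʳ us ∈vs

count-≤-injection : {A B : Set} {P : Pred A 0ℓ} {Q : Pred B 0ℓ} (P? : Decidable P) (Q? : Decidable Q)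
  (f : A → B) {xs : List A} {ys : List B} → Unique xs → (∀ b → b ∈ₗ ys) →
  (∀ {a} → P a → Q (f a)) → (∀ {a a′} → P a → P a′ → f a ≡ f a′ → a ≡ a′) →
  count P? xs ≤ count Q? ys
count-≤-injection P? Q? f {xs} unique complete P⇒Q∘f injective =
  length-≤-injection f (filter⁺ P? unique)
    (λ p q → injective (satisfies p) (satisfies q))
    (λ p → ∈-filter⁺ Q? (complete _) (P⇒Q∘f (satisfies p)))
  where satisfies = λ {a} (a∈ : a ∈ₗ filter P? xs) → proj₂ (∈-filter⁻ P? {xs = xs} a∈)

module _ {A C : Set} {P : Pred A 0ℓ} {R : A → Pred C 0ℓ}
         (P? : Decidable P) (R? : ∀ a → Decidable (R a)) (zs : List C) where

  Paired : Pred (A × C) 0ℓ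
  Paired (a , c) = P a × R a c

  paired? : Decidable Paired
  paired? (a , c) = P? a ×-dec R? a c

  private
    count-paired-∷ : ∀ x xs → count paired? (cartesianProduct (x ∷ xs) zs)
      ≡ count (paired? ∘ (x ,_)) zs + count paired? (cartesianProduct xs zs)
    count-paired-∷ x xs = trans (count-++ paired? (map (x ,_) zs) _)
                                (cong (_+ _) (count-map paired? (x ,_) zs))

    count-paired-accept : ∀ {x} → P x → count (paired? ∘ (x ,_)) zs ≡ count (R? x) zs
    count-paired-accept px = count-cong _ (R? _) (proj₂ , (px ,_)) zs

    count-paired-reject : ∀ {x} → ¬ P x → count (paired? ∘ (x ,_)) zs ≡ 0
    count-paired-reject ¬px = count-none _ zs (λ _ → ¬px ∘ proj₁)

  *-count≤count-paired : ∀ {m} → (∀ {a} → P a → m ≤ count (R? a) zs) →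
    ∀ xs → m * count P? xs ≤ count paired? (cartesianProduct xs zs)
  *-count≤count-paired {m} _ [] = ≤-reflexive (*-zeroʳ m)
  *-count≤count-paired {m} low (x ∷ xs) with P? x
  ... | yes px = begin
    m * suc (count P? xs)  ≡⟨ *-suc m _ ⟩
    m + m * count P? xs    ≤⟨ +-mono-≤ (low px) (*-count≤count-paired low xs) ⟩
    count (R? x) zs + _    ≡⟨ cong (_+ _) (count-paired-accept px) ⟨
    count (paired? ∘ (x ,_)) zs + _ ≡⟨ count-paired-∷ x xs ⟨
    count paired? (cartesianProduct (x ∷ xs) zs) ∎
    where open ≤-Reasoning
  ... | no ¬px = begin
    m * count P? xs  ≤⟨ *-count≤count-paired low xs ⟩
    count paired? (cartesianProduct xs zs) ≡⟨ cong (_+ _) (count-paired-reject ¬px) ⟨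
    count (paired? ∘ (x ,_)) zs + _ ≡⟨ count-paired-∷ x xs ⟨
    count paired? (cartesianProduct (x ∷ xs) zs) ∎
    where open ≤-Reasoning

  count-paired≤*-count : ∀ {m} → (∀ {a} → P a → count (R? a) zs ≤ m) →
    ∀ xs → count paired? (cartesianProduct xs zs) ≤ m * count P? xs
  count-paired≤*-count {m} _ [] = ≤-reflexive (sym (*-zeroʳ m))
  count-paired≤*-count {m} high (x ∷ xs) with P? x
  ... | yes px = begin
    count paired? (cartesianProduct (x ∷ xs) zs) ≡⟨ count-paired-∷ x xs ⟩
    count (paired? ∘ (x ,_)) zs + _ ≡⟨ cong (_+ _) (count-paired-accept px) ⟩
    count (R? x) zs + _    ≤⟨ +-mono-≤ (high px) (count-paired≤*-count high xs) ⟩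
    m + m * count P? xs    ≡⟨ *-suc m _ ⟨
    m * suc (count P? xs)  ∎
    where open ≤-Reasoning
  ... | no ¬px = begin
    count paired? (cartesianProduct (x ∷ xs) zs) ≡⟨ count-paired-∷ x xs ⟩
    count (paired? ∘ (x ,_)) zs + _ ≡⟨ cong (_+ _) (count-paired-reject ¬px) ⟩
    count paired? (cartesianProduct xs zs) ≤⟨ count-paired≤*-count high xs ⟩
    m * count P? xs  ∎
    where open ≤-Reasoning

private
  count-∈-suc : ∀ {n} b (p : Subset n) → count (_∈? b ∷ p) (tabulate suc) ≡ count (_∈? p) (allFin n)
  count-∈-suc {n} b p = begin
    count (_∈? b ∷ p) (tabulate suc)        ≡⟨ cong (count (_∈? b ∷ p)) (map-tabulate (λ i → i) suc) ⟨
    count (_∈? b ∷ p) (map suc (allFin n))  ≡⟨ count-map (_∈? b ∷ p) suc (allFin n) ⟩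
    count ((_∈? b ∷ p) ∘ suc) (allFin n)    ≡⟨ count-cong _ (_∈? p) (drop-there , there) (allFin n) ⟩
    count (_∈? p) (allFin n)                ∎
    where open ≡-Reasoning

count-∈≡∣∣ : ∀ {n} (p : Subset n) → count (_∈? p) (allFin n) ≡ ∣ p ∣
count-∈≡∣∣ [] = refl
count-∈≡∣∣ (outside ∷ p) =
  trans (count-reject (_∈? outside ∷ p) {zero} (tabulate suc) λ ()) (trans (count-∈-suc outside p) (count-∈≡∣∣ p))
count-∈≡∣∣ (inside ∷ p) =
  trans (count-accept (_∈? inside ∷ p) {zero} (tabulate suc) here) (cong suc (trans (count-∈-suc inside p) (count-∈≡∣∣ p)))

allSubsets-complete : ∀ {n} (p : Subset n) → p ∈ₗ allSubsets n
allSubsets-complete []            = here refl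
allSubsets-complete (outside ∷ p) = ∈-++⁺ˡ (∈-map⁺ (outside ∷_) (allSubsets-complete p))
allSubsets-complete {suc n} (inside ∷ p) =
  ∈-++⁺ʳ (map (outside ∷_) (allSubsets n)) (∈-map⁺ (inside ∷_) (allSubsets-complete p))

allSubsets-unique : ∀ n → Unique (allSubsets n)
allSubsets-unique zero    = All.[] ∷ []
allSubsets-unique (suc n) = ++⁺ (map⁺ ∷-injectiveʳ (allSubsets-unique n)) (map⁺ ∷-injectiveʳ (allSubsets-unique n)) disjoint
  where
  disjoint : ∀ {p} → ¬ (p ∈ₗ map (outside ∷_) (allSubsets n) × p ∈ₗ map (inside ∷_) (allSubsets n))
  disjoint (p∈outs , p∈ins) with ∈-map⁻ _ p∈outs | ∈-map⁻ _ p∈ins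
  ... | _ , _ , refl | _ , _ , ()

x∈p─q⇒x∉q : ∀ {n} {x : Fin n} {p q} → x ∈ p ─ q → x ∉ q
x∈p─q⇒x∉q {p = _ ∷ _} {inside ∷ _} () here
x∈p─q⇒x∉q {p = _ ∷ _} {_ ∷ _} (there x∈p─q) (there x∈q) = x∈p─q⇒x∉q x∈p─q x∈q

∣p─q∣+∣p∩q∣≡∣p∣ : ∀ {n} (p q : Subset n) → ∣ p ─ q ∣ + ∣ p ∩ q ∣ ≡ ∣ p ∣
∣p─q∣+∣p∩q∣≡∣p∣ [] [] = refl
∣p─q∣+∣p∩q∣≡∣p∣ (inside  ∷ p) (inside  ∷ q) = trans (+-suc _ _) (cong suc (∣p─q∣+∣p∩q∣≡∣p∣ p q))
∣p─q∣+∣p∩q∣≡∣p∣ (inside  ∷ p) (outside ∷ q) = cong suc (∣p─q∣+∣p∩q∣≡∣p∣ p q)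
∣p─q∣+∣p∩q∣≡∣p∣ (outside ∷ p) (inside  ∷ q) = ∣p─q∣+∣p∩q∣≡∣p∣ p q
∣p─q∣+∣p∩q∣≡∣p∣ (outside ∷ p) (outside ∷ q) = ∣p─q∣+∣p∩q∣≡∣p∣ p q

∣p∣∸∣q∣≤∣p─q∣ : ∀ {n} (p q : Subset n) → ∣ p ∣ ∸ ∣ q ∣ ≤ ∣ p ─ q ∣
∣p∣∸∣q∣≤∣p─q∣ p q = m≤n+o⇒m∸n≤o ∣ p ∣ ∣ q ∣ (begin
  ∣ p ∣                    ≡⟨ ∣p─q∣+∣p∩q∣≡∣p∣ p q ⟨
  ∣ p ─ q ∣ + ∣ p ∩ q ∣    ≤⟨ +-monoʳ-≤ ∣ p ─ q ∣ (∣p∩q∣≤∣q∣ p q) ⟩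
  ∣ p ─ q ∣ + ∣ q ∣        ≡⟨ +-comm ∣ p ─ q ∣ ∣ q ∣ ⟩
  ∣ q ∣ + ∣ p ─ q ∣        ∎)
  where open ≤-Reasoning

q⊆p⇒p∩q≡q : ∀ {n} {p q : Subset n} → q ⊆ p → p ∩ q ≡ q
q⊆p⇒p∩q≡q {p = p} {q = q} q⊆p = ⊆-antisym (p∩q⊆q p q) (λ x∈q → x∈p∩q⁺ (q⊆p x∈q , x∈q))

q⊆p⇒∣p─q∣≡∣p∣∸∣q∣ : ∀ {n} {p q : Subset n} → q ⊆ p → ∣ p ─ q ∣ ≡ ∣ p ∣ ∸ ∣ q ∣
q⊆p⇒∣p─q∣≡∣p∣∸∣q∣ {p = p} {q = q} q⊆p = begin
  ∣ p ─ q ∣                  ≡⟨ m+n∸n≡m ∣ p ─ q ∣ ∣ q ∣ ⟨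
  ∣ p ─ q ∣ + ∣ q ∣ ∸ ∣ q ∣  ≡⟨ cong (λ r → ∣ p ─ q ∣ + ∣ r ∣ ∸ ∣ q ∣) (q⊆p⇒p∩q≡q q⊆p) ⟨
  ∣ p ─ q ∣ + ∣ p ∩ q ∣ ∸ ∣ q ∣ ≡⟨ cong (_∸ ∣ q ∣) (∣p─q∣+∣p∩q∣≡∣p∣ p q) ⟩
  ∣ p ∣ ∸ ∣ q ∣              ∎
  where open ≡-Reasoning

q⊆p⇒p─q∪q≡p : ∀ {n} {p q : Subset n} → q ⊆ p → (p ─ q) ∪ q ≡ p
q⊆p⇒p─q∪q≡p {p = p} {q = q} q⊆p = ⊆-antisym ⊆p ⊇p
  where
  ⊆p : (p ─ q) ∪ q ⊆ p
  ⊆p x∈ with x∈p∪q⁻ (p ─ q) q x∈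
  ... | inj₁ x∈p─q = p─q⊆p p q x∈p─q
  ... | inj₂ x∈q   = q⊆p x∈q
  ⊇p : p ⊆ (p ─ q) ∪ q
  ⊇p {x} x∈p with x ∈? q
  ... | yes x∈q = x∈p∪q⁺ (inj₂ x∈q)
  ... | no  x∉q = x∈p∪q⁺ (inj₁ (x∈p∧x∉q⇒x∈p─q x∈p x∉q))

x∈p⇒∣p∣≡1+∣p-x∣ : ∀ {n} {x : Fin n} {p} → x ∈ p → ∣ p ∣ ≡ suc ∣ p - x ∣
x∈p⇒∣p∣≡1+∣p-x∣ {p = inside ∷ p} here = cong (suc ∘ ∣_∣) (sym (p─⊥≡p p))
x∈p⇒∣p∣≡1+∣p-x∣ {p = inside  ∷ _} (there x∈p) = cong suc (x∈p⇒∣p∣≡1+∣p-x∣ x∈p)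
x∈p⇒∣p∣≡1+∣p-x∣ {p = outside ∷ _} (there x∈p) = x∈p⇒∣p∣≡1+∣p-x∣ x∈p

x∉p⇒∣p∪⁅x⁆∣≡1+∣p∣ : ∀ {n} {x : Fin n} {p} → x ∉ p → ∣ p ∪ ⁅ x ⁆ ∣ ≡ suc ∣ p ∣
x∉p⇒∣p∪⁅x⁆∣≡1+∣p∣ {x = zero}  {p = inside  ∷ p} x∉p = contradiction here x∉p
x∉p⇒∣p∪⁅x⁆∣≡1+∣p∣ {x = zero}  {p = outside ∷ p} x∉p = cong (suc ∘ ∣_∣) (∪-identityʳ p)
x∉p⇒∣p∪⁅x⁆∣≡1+∣p∣ {x = suc x} {p = inside  ∷ p} x∉p = cong suc (x∉p⇒∣p∪⁅x⁆∣≡1+∣p∣ (x∉p ∘ there))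
x∉p⇒∣p∪⁅x⁆∣≡1+∣p∣ {x = suc x} {p = outside ∷ p} x∉p = x∉p⇒∣p∪⁅x⁆∣≡1+∣p∣ (x∉p ∘ there)

exchange : ∀ {n} → Subset n → Fin n → Fin n → Subset n
exchange A x y = (A - x) ∪ ⁅ y ⁆

∈-exchange⁻ : ∀ {n} {A : Subset n} {x y i} → i ∈ exchange A x y → (i ∈ A × i ≢ x) ⊎ i ≡ y
∈-exchange⁻ {A = A} {x} {y} i∈ with x∈p∪q⁻ (A - x) ⁅ y ⁆ i∈
... | inj₁ i∈A-x = inj₁ (p─q⊆p A ⁅ x ⁆ i∈A-x , x∉⁅y⁆⇒x≢y (x∈p─q⇒x∉q i∈A-x))
... | inj₂ i∈⁅y⁆ = inj₂ (x∈⁅y⁆⇒x≡y y i∈⁅y⁆)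

∈-exchange⁺ : ∀ {n} {A : Subset n} {x y i} → (i ∈ A × i ≢ x) ⊎ i ≡ y → i ∈ exchange A x y
∈-exchange⁺ (inj₁ (i∈A , i≢x)) = x∈p∪q⁺ (inj₁ (x∈p∧x≢y⇒x∈p-y i∈A i≢x))
∈-exchange⁺ {y = y} (inj₂ refl) = x∈p∪q⁺ (inj₂ (x∈⁅x⁆ y))

∣exchange∣ : ∀ {n} {A : Subset n} {x y} → x ∈ A → y ∉ A → ∣ exchange A x y ∣ ≡ ∣ A ∣
∣exchange∣ {A = A} {x} x∈A y∉A = trans (x∉p⇒∣p∪⁅x⁆∣≡1+∣p∣ (y∉A ∘ p─q⊆p A ⁅ x ⁆)) (sym (x∈p⇒∣p∣≡1+∣p-x∣ x∈A))

exchange-inverse : ∀ {n} {A : Subset n} {x y} → x ∈ A → y ∉ A → exchange (exchange A x y) y x ≡ A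
exchange-inverse {A = A} {x} {y} x∈A y∉A = ⊆-antisym ⊆A ⊇A
  where
  ⊆A : exchange (exchange A x y) y x ⊆ A
  ⊆A i∈ with ∈-exchange⁻ i∈
  ... | inj₂ refl = x∈A
  ... | inj₁ (i∈exchange , i≢y) with ∈-exchange⁻ i∈exchange
  ...   | inj₁ (i∈A , _) = i∈A
  ...   | inj₂ i≡y       = contradiction i≡y i≢y
  ⊇A : A ⊆ exchange (exchange A x y) y x
  ⊇A {i} i∈A with i ≟ x
  ... | yes refl = ∈-exchange⁺ (inj₂ refl)
  ... | no  i≢x  = ∈-exchange⁺ (inj₁ (∈-exchange⁺ (inj₁ (i∈A , i≢x)) , λ { refl → y∉A i∈A }))

module _ {N : ℕ} {𝒜 : Family N} where

  level⁻ : ∀ {k A} → T (level k 𝒜 A) → A ∈ᶠ 𝒜 × ∣ A ∣ ≡ k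
  level⁻ {k} {A} A∈ with 𝒜 A
  ... | true = refl , ≡ᵇ⇒≡ ∣ A ∣ k A∈

  level⁺ : ∀ {k A} → A ∈ᶠ 𝒜 → ∣ A ∣ ≡ k → T (level k 𝒜 A)
  level⁺ {k} {A} A∈𝒜 ∣A∣≡k rewrite A∈𝒜 = ≡⇒≡ᵇ ∣ A ∣ k ∣A∣≡k

  link⁻ : ∀ {X B} → T (link 𝒜 X B) → ∃[ A ] T (𝒜 A) × X ⊆ A × A ─ X ≡ B
  link⁻ {X} {B} B∈ with A , A∈ ← satisfied (any⁻ _ (allSubsets N) B∈) =
    let A∈𝒜 , rest = Equivalence.to T-∧ A∈
        X⊆A , A─X≡B = Equivalence.to T-∧ rest
    in A , A∈𝒜 , toWitness {a? = X ⊆? A} X⊆A , toWitness {a? = ≡-dec Bool._≟_ (A ─ X) B} A─X≡B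

  link₂⁺ : ∀ {X Y A} → T (𝒜 A) → A ∩ Y ≡ X → T (link₂ 𝒜 X Y (A ─ X))
  link₂⁺ {X} {Y} {A} A∈𝒜 A∩Y≡X = any⁺ _ (lose (allSubsets-complete A)
    (Equivalence.from T-∧ (A∈𝒜 , Equivalence.from T-∧
      (fromWitness {a? = ≡-dec Bool._≟_ (A ∩ Y) X} A∩Y≡X , fromWitness {a? = ≡-dec Bool._≟_ (A ─ X) (A ─ X)} refl))))

_⊂?_ : ∀ {n} (A B : Subset n) → Dec (A ⊂ B)
A ⊂? B = A ⊆? B ×-dec any? (λ x → x ∈? B ×-dec ¬? (x ∈? A))

⊆-maximal : ∀ {N} (𝒞 : Family N) {A} → A ∈ᶠ 𝒞 → ∃[ M ] IsMaximal 𝒞 M × A ⊆ M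
⊆-maximal 𝒞 {A} = go (⊃-wellFounded A)
  where
  go : ∀ {A} → Acc _⊃_ A → A ∈ᶠ 𝒞 → ∃[ M ] IsMaximal 𝒞 M × A ⊆ M
  go {A} (acc below) A∈𝒞 with anySubset? (λ B → (𝒞 B Bool.≟ true) ×-dec A ⊂? B)
  ... | yes (B , B∈𝒞 , A⊂B) =
    let M , M-maximal , B⊆M = go (below A⊂B) B∈𝒞 in M , M-maximal , ⊆-trans (proj₁ A⊂B) B⊆M
  ... | no ∄B = A , (A∈𝒞 , λ B B∈𝒞 A⊆B → ⊆-antisym (B⊆A B∈𝒞 A⊆B) A⊆B) , ⊆-refl
    where
    B⊆A : ∀ {B} → B ∈ᶠ 𝒞 → A ⊆ B → B ⊆ A
    B⊆A {B} B∈𝒞 A⊆B {x} x∈B = decidable-stable (x ∈? A) λ x∉A → ∄B (B , B∈𝒞 , A⊆B , x , x∈B , x∉A)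

u*[a+b]≤[u+d]*b : ∀ {u m d a b} → u ≤ m → m * a ≤ d * b → u * (a + b) ≤ (u + d) * b
u*[a+b]≤[u+d]*b {u} {m} {d} {a} {b} u≤m ma≤db = begin
  u * (a + b)    ≡⟨ *-distribˡ-+ u a b ⟩
  u * a + u * b  ≤⟨ +-monoˡ-≤ (u * b) (≤-trans (*-monoˡ-≤ a u≤m) ma≤db) ⟩
  d * b + u * b  ≡⟨ *-distribʳ-+ b d u ⟨
  (d + u) * b    ≡⟨ cong (_* b) (+-comm d u) ⟩
  (u + d) * b    ∎
  where open ≤-Reasoning

module Faces {N : ℕ} (𝒞 : Family N) (k : ℕ) (X : Subset N) where

  -- In the paper's notation, faces G is |𝒞^(k)(X, X ∪ G)|.
  Face : Subset N → Pred (Subset N) 0ℓ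
  Face G A = T (level k 𝒞 A) × X ⊆ A × A ⊆ ∁ G

  face? : ∀ G → Decidable (Face G)
  face? G A = T? (level k 𝒞 A) ×-dec X ⊆? A ×-dec A ⊆? ∁ G

  faces : Subset N → ℕ
  faces G = count (face? G) (allSubsets N)

  face-level : ∀ {G A} → Face G A → A ∈ᶠ 𝒞 × ∣ A ∣ ≡ k
  face-level {A = A} (A∈level , _) = level⁻ {𝒜 = 𝒞} {k} {A} A∈level

  faces≡0 : ∀ {G} → k < ∣ X ∣ → faces G ≡ 0
  faces≡0 k<∣X∣ = count-none _ (allSubsets N) λ A A-face@(_ , X⊆A , _) →
    <⇒≱ k<∣X∣ (≤-trans (p⊆q⇒∣p∣≤∣q∣ X⊆A) (≤-reflexive (proj₂ (face-level A-face))))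

  card-link≤faces⊥ : card (link (level k 𝒞) X) ≤ faces ⊥
  card-link≤faces⊥ = count-≤-injection (T? ∘ link (level k 𝒞) X) (face? ⊥) (_∪ X)
    (allSubsets-unique N) allSubsets-complete into injective
    where
    into : ∀ {B} → T (link (level k 𝒞) X B) → Face ⊥ (B ∪ X)
    into {B} B∈ with A , A∈level , X⊆A , refl ← link⁻ {𝒜 = level k 𝒞} {X} {B} B∈ rewrite q⊆p⇒p─q∪q≡p X⊆A =
      A∈level , X⊆A , λ _ → x∉p⇒x∈∁p ∉⊥
    injective : ∀ {B B′} → T (link (level k 𝒞) X B) → T (link (level k 𝒞) X B′) → B ∪ X ≡ B′ ∪ X → B ≡ B′
    injective {B} {B′} B∈ B′∈ B∪X≡B′∪X
      with _ , _ , X⊆A , refl ← link⁻ {𝒜 = level k 𝒞} {X} {B} B∈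
         | _ , _ , X⊆A′ , refl ← link⁻ {𝒜 = level k 𝒞} {X} {B′} B′∈ =
      cong (_─ X) (trans (sym (q⊆p⇒p─q∪q≡p X⊆A)) (trans B∪X≡B′∪X (q⊆p⇒p─q∪q≡p X⊆A′)))

  faces≤card-link₂ : ∀ F → faces (F ─ X) ≤ card (link₂ (level k 𝒞) X (F ∪ X))
  faces≤card-link₂ F = count-≤-injection (face? (F ─ X)) (T? ∘ link₂ (level k 𝒞) X (F ∪ X)) (_─ X)
    (allSubsets-unique N) allSubsets-complete into injective
    where
    trace : ∀ {A} → Face (F ─ X) A → A ∩ (F ∪ X) ≡ X
    trace {A} (_ , X⊆A , A⊆∁F─X) = ⊆-antisym ⊆X (λ i∈X → x∈p∩q⁺ (X⊆A i∈X , x∈p∪q⁺ (inj₂ i∈X)))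
      where
      ⊆X : A ∩ (F ∪ X) ⊆ X
      ⊆X {i} i∈ with x∈p∩q⁻ A (F ∪ X) i∈ | i ∈? X
      ... | _ , _ | yes i∈X = i∈X
      ... | i∈A , i∈F∪X | no i∉X with x∈p∪q⁻ F X i∈F∪X
      ...   | inj₁ i∈F = contradiction (x∈p∧x∉q⇒x∈p─q i∈F i∉X) (x∈∁p⇒x∉p (A⊆∁F─X i∈A))
      ...   | inj₂ i∈X = i∈X
    into : ∀ {A} → Face (F ─ X) A → T (link₂ (level k 𝒞) X (F ∪ X) (A ─ X))
    into A-face@(A∈level , _) = link₂⁺ {𝒜 = level k 𝒞} A∈level (trace A-face)
    injective : ∀ {A A′} → Face (F ─ X) A → Face (F ─ X) A′ → A ─ X ≡ A′ ─ X → A ≡ A′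
    injective (_ , X⊆A , _) (_ , X⊆A′ , _) A─X≡A′─X =
      trans (sym (q⊆p⇒p─q∪q≡p X⊆A)) (trans (cong (_∪ X) A─X≡A′─X) (q⊆p⇒p─q∪q≡p X⊆A′))

  module _ (closed : IsSimplicialComplex 𝒞) {n : ℕ} (large : ∀ A → IsMaximal 𝒞 A → n ≤ ∣ A ∣) where

    module _ {G : Subset N} {x : Fin N} (x∉X : x ∉ X) where

      private
        Exchangeable : Subset N → Pred (Fin N) 0ℓ
        Exchangeable A y = y ∉ A × y ∉ G × exchange A x y ∈ᶠ 𝒞

        exchangeable? : ∀ A → Decidable (Exchangeable A)
        exchangeable? A y = ¬? (y ∈? A) ×-dec ¬? (y ∈? G) ×-dec (𝒞 (exchange A x y) Bool.≟ true)

        containing? : Decidable λ A → Face G A × x ∈ A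
        containing? = face? G ∩? (x ∈?_)

        avoiding? : Decidable λ A → Face G A × x ∉ A
        avoiding? = face? G ∩? ∁? (x ∈?_)

        outside-X? : ∀ A → Decidable (_∈ A ─ X)
        outside-X? A = _∈? A ─ X

        many-exchangeable : ∀ {A} → Face G A × x ∈ A → n ∸ k ∸ ∣ G ∣ ≤ count (exchangeable? A) (allFin N)
        many-exchangeable {A} (A-face , _) with A∈𝒞 , ∣A∣≡k ← face-level A-face
          with M , M-maximal@(M∈𝒞 , _) , A⊆M ← ⊆-maximal 𝒞 A∈𝒞 = begin
          n ∸ k ∸ ∣ G ∣                ≤⟨ ∸-monoˡ-≤ ∣ G ∣ (∸-mono (large M M-maximal) (≤-reflexive ∣A∣≡k)) ⟩
          ∣ M ∣ ∸ ∣ A ∣ ∸ ∣ G ∣        ≤⟨ ∸-monoˡ-≤ ∣ G ∣ (∣p∣∸∣q∣≤∣p─q∣ M A) ⟩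
          ∣ M ─ A ∣ ∸ ∣ G ∣            ≤⟨ ∣p∣∸∣q∣≤∣p─q∣ (M ─ A) G ⟩
          ∣ M ─ A ─ G ∣                ≡⟨ count-∈≡∣∣ (M ─ A ─ G) ⟨
          count (_∈? M ─ A ─ G) (allFin N) ≤⟨ count-mono (_∈? M ─ A ─ G) (exchangeable? A) exchangeable (allFin N) ⟩
          count (exchangeable? A) (allFin N) ∎
          where
          open ≤-Reasoning
          exchangeable : ∀ {y} → y ∈ M ─ A ─ G → Exchangeable A y
          exchangeable {y} y∈ = x∈p─q⇒x∉q y∈M─A , x∈p─q⇒x∉q y∈ , closed M _ M∈𝒞 exchange⊆M
            where
            y∈M─A = p─q⊆p (M ─ A) G y∈
            exchange⊆M : exchange A x y ⊆ M
            exchange⊆M i∈ with ∈-exchange⁻ i∈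
            ... | inj₁ (i∈A , _) = A⊆M i∈A
            ... | inj₂ refl      = p─q⊆p M A y∈M─A

        few-outside-X : ∀ {A} → Face G A × x ∉ A → count (outside-X? A) (allFin N) ≤ k ∸ ∣ X ∣
        few-outside-X {A} (A-face@(_ , X⊆A , _) , _) = ≤-reflexive (begin
          count (_∈? A ─ X) (allFin N) ≡⟨ count-∈≡∣∣ (A ─ X) ⟩
          ∣ A ─ X ∣                    ≡⟨ q⊆p⇒∣p─q∣≡∣p∣∸∣q∣ X⊆A ⟩
          ∣ A ∣ ∸ ∣ X ∣                ≡⟨ cong (_∸ ∣ X ∣) (proj₂ (face-level A-face)) ⟩
          k ∸ ∣ X ∣                    ∎)
          where open ≡-Reasoning

        exchange-pair : Subset N × Fin N → Subset N × Fin N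
        exchange-pair (A , y) = exchange A x y , y

        exchange-pair-into : ∀ {Ay} → Paired containing? exchangeable? (allFin N) Ay →
                             Paired avoiding? outside-X? (allFin N) (exchange-pair Ay)
        exchange-pair-into {A , y} ((A-face@(_ , X⊆A , A⊆∁G) , x∈A) , y∉A , y∉G , exchange∈𝒞) =
          (( level⁺ {𝒜 = 𝒞} exchange∈𝒞 (trans (∣exchange∣ x∈A y∉A) (proj₂ (face-level A-face)))
           , X⊆exchange , exchange⊆∁G) , x∉exchange)
          , x∈p∧x∉q⇒x∈p─q (∈-exchange⁺ (inj₂ refl)) (y∉A ∘ X⊆A)
          where
          X⊆exchange : X ⊆ exchange A x y
          X⊆exchange i∈X = ∈-exchange⁺ (inj₁ (X⊆A i∈X , λ { refl → x∉X i∈X }))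
          exchange⊆∁G : exchange A x y ⊆ ∁ G
          exchange⊆∁G i∈ with ∈-exchange⁻ i∈
          ... | inj₁ (i∈A , _) = A⊆∁G i∈A
          ... | inj₂ refl      = x∉p⇒x∈∁p y∉G
          x∉exchange : x ∉ exchange A x y
          x∉exchange x∈ with ∈-exchange⁻ x∈
          ... | inj₁ (_ , x≢x) = x≢x refl
          ... | inj₂ refl      = y∉A x∈A

        exchange-pair-injective : ∀ {Ay Ay′} → Paired containing? exchangeable? (allFin N) Ay →
                                  Paired containing? exchangeable? (allFin N) Ay′ →
                                  exchange-pair Ay ≡ exchange-pair Ay′ → Ay ≡ Ay′
        exchange-pair-injective {A , y} {A′ , y′} ((_ , x∈A) , y∉A , _) ((_ , x∈A′) , y∉A′ , _) same
          with refl ← cong proj₂ same = cong (_, y) (begin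
            A                               ≡⟨ exchange-inverse x∈A y∉A ⟨
            exchange (exchange A x y) y x   ≡⟨ cong (λ B → exchange B y x) (cong proj₁ same) ⟩
            exchange (exchange A′ x y) y x  ≡⟨ exchange-inverse x∈A′ y∉A′ ⟩
            A′                              ∎)
          where open ≡-Reasoning

      exchange-bound : (n ∸ k ∸ ∣ G ∣) * count (face? G ∩? (x ∈?_)) (allSubsets N)
                     ≤ (k ∸ ∣ X ∣) * count (face? G ∩? ∁? (x ∈?_)) (allSubsets N)
      exchange-bound = begin
        (n ∸ k ∸ ∣ G ∣) * count containing? (allSubsets N)
          ≤⟨ *-count≤count-paired containing? exchangeable? (allFin N) many-exchangeable (allSubsets N) ⟩
        count (paired? containing? exchangeable? (allFin N)) pairs
          ≤⟨ count-≤-injection _ _ exchange-pair pairs-unique pairs-complete exchange-pair-into exchange-pair-injective ⟩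
        count (paired? avoiding? outside-X? (allFin N)) pairs
          ≤⟨ count-paired≤*-count avoiding? outside-X? (allFin N) few-outside-X (allSubsets N) ⟩
        (k ∸ ∣ X ∣) * count avoiding? (allSubsets N) ∎
        where
        open ≤-Reasoning
        pairs : List (Subset N × Fin N)
        pairs = cartesianProduct (allSubsets N) (allFin N)
        pairs-unique : Unique pairs
        pairs-unique = cartesianProduct⁺ (allSubsets-unique N) (allFin⁺ N)
        pairs-complete : ∀ Ay → Ay ∈ₗ pairs
        pairs-complete (A , y) = ∈-cartesianProduct⁺ (allSubsets-complete A) (∈-allFin y)

    module _ {s : ℕ} (∣X∣≤k : ∣ X ∣ ≤ k) (k+s≤n : k + s ≤ n) where

      private
        u w : ℕ
        u = n ∸ s ∸ k
        w = n ∸ s ∸ ∣ X ∣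

        u≤w : u ≤ w
        u≤w = ∸-monoʳ-≤ (n ∸ s) ∣X∣≤k

        u+[k∸∣X∣]≡w : u + (k ∸ ∣ X ∣) ≡ w
        u+[k∸∣X∣]≡w = begin
          n ∸ s ∸ k + (k ∸ ∣ X ∣)   ≡⟨ +-∸-assoc (n ∸ s ∸ k) ∣X∣≤k ⟨
          n ∸ s ∸ k + k ∸ ∣ X ∣     ≡⟨ cong (_∸ ∣ X ∣) (m∸n+n≡m (m+n≤o⇒m≤o∸n k k+s≤n)) ⟩
          n ∸ s ∸ ∣ X ∣             ∎
          where open ≡-Reasoning

        u≤n∸k∸g : ∀ {g} → g ≤ s → u ≤ n ∸ k ∸ g
        u≤n∸k∸g {g} g≤s = begin
          n ∸ s ∸ k    ≡⟨ ∸-+-assoc n s k ⟩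
          n ∸ (s + k)  ≤⟨ ∸-monoʳ-≤ n (≤-trans (+-monoʳ-≤ k g≤s) (≤-reflexive (+-comm k s))) ⟩
          n ∸ (k + g)  ≡⟨ ∸-+-assoc n k g ⟨
          n ∸ k ∸ g    ∎
          where open ≤-Reasoning

      faces-step : ∀ {G x} → x ∈ G → x ∉ X → ∣ G ∣ ≤ s →
                   (n ∸ s ∸ k) * faces (G - x) ≤ (n ∸ s ∸ ∣ X ∣) * faces G
      faces-step {G} {x} x∈G x∉X ∣G∣≤s = begin
        u * faces (G - x)
          ≡⟨ cong (u *_) (count-split (face? (G - x)) (x ∈?_) (allSubsets N)) ⟩
        u * (count (face? (G - x) ∩? (x ∈?_)) (allSubsets N) + count (face? (G - x) ∩? ∁? (x ∈?_)) (allSubsets N))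
          ≤⟨ u*[a+b]≤[u+d]*b (u≤n∸k∸g (≤-trans (∣p─q∣≤∣p∣ G ⁅ x ⁆) ∣G∣≤s)) (exchange-bound {G = G - x} x∉X) ⟩
        (u + (k ∸ ∣ X ∣)) * count (face? (G - x) ∩? ∁? (x ∈?_)) (allSubsets N)
          ≡⟨ cong₂ _*_ u+[k∸∣X∣]≡w (count-cong _ (face? G) (avoiding⇒face , face⇒avoiding) (allSubsets N)) ⟩
        w * faces G ∎
        where
        open ≤-Reasoning
        avoiding⇒face : ∀ {A} → Face (G - x) A × x ∉ A → Face G A
        avoiding⇒face {A} ((A∈level , X⊆A , A⊆∁G-x) , x∉A) = A∈level , X⊆A , A⊆∁G
          where
          A⊆∁G : A ⊆ ∁ G
          A⊆∁G {i} i∈A with i ≟ x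
          ... | yes refl = contradiction i∈A x∉A
          ... | no  i≢x  = x∉p⇒x∈∁p λ i∈G → x∈∁p⇒x∉p (A⊆∁G-x i∈A) (x∈p∧x≢y⇒x∈p-y i∈G i≢x)
        face⇒avoiding : ∀ {A} → Face G A → Face (G - x) A × x ∉ A
        face⇒avoiding (A∈level , X⊆A , A⊆∁G) =
          (A∈level , X⊆A , λ i∈A → x∉p⇒x∈∁p (x∈∁p⇒x∉p (A⊆∁G i∈A) ∘ p─q⊆p G ⁅ x ⁆)) ,
          λ x∈A → x∈∁p⇒x∉p (A⊆∁G x∈A) x∈G

      faces-iterate : ∀ m {G} → ∣ G ∣ ≤ m → m ≤ s → G ⊆ ∁ X →
                      (n ∸ s ∸ k) ^ m * faces ⊥ ≤ (n ∸ s ∸ ∣ X ∣) ^ m * faces G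
      faces-iterate m {G} ∣G∣≤m m≤s G⊆∁X with nonempty? G
      ... | no G-empty rewrite Empty-unique G-empty = *-monoˡ-≤ (faces ⊥) (^-monoˡ-≤ m u≤w)
      faces-iterate zero {G} ∣G∣≤0 _ _ | yes (x , x∈G) =
        contradiction (≤-trans (≤-reflexive (sym (x∈p⇒∣p∣≡1+∣p-x∣ x∈G))) ∣G∣≤0) λ ()
      faces-iterate (suc m) {G} ∣G∣≤1+m 1+m≤s G⊆∁X | yes (x , x∈G) = begin
        u * u ^ m * faces ⊥          ≡⟨ *-assoc u (u ^ m) (faces ⊥) ⟩
        u * (u ^ m * faces ⊥)        ≤⟨ *-monoʳ-≤ u (faces-iterate m ∣G-x∣≤m (<⇒≤ 1+m≤s) G-x⊆∁X) ⟩
        u * (w ^ m * faces (G - x))  ≡⟨ x∙yz≈y∙xz u (w ^ m) (faces (G - x)) ⟩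
        w ^ m * (u * faces (G - x))  ≤⟨ *-monoʳ-≤ (w ^ m) (faces-step x∈G (x∈∁p⇒x∉p (G⊆∁X x∈G)) (≤-trans ∣G∣≤1+m 1+m≤s)) ⟩
        w ^ m * (w * faces G)        ≡⟨ x∙yz≈y∙xz (w ^ m) w (faces G) ⟩
        w * (w ^ m * faces G)        ≡⟨ *-assoc w (w ^ m) (faces G) ⟨
        w * w ^ m * faces G          ∎
        where
        open ≤-Reasoning
        ∣G-x∣≤m : ∣ G - x ∣ ≤ m
        ∣G-x∣≤m = s≤s⁻¹ (≤-trans (≤-reflexive (sym (x∈p⇒∣p∣≡1+∣p-x∣ x∈G))) ∣G∣≤1+m)
        G-x⊆∁X : G - x ⊆ ∁ X
        G-x⊆∁X = G⊆∁X ∘ p─q⊆p G ⁅ x ⁆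

lemma7 : (n s k t N : ℕ) → 1 ≤ n → 1 ≤ s → 1 ≤ k → 1 ≤ t →
    (𝒞 : Family N) → IsSimplicialComplex 𝒞 →
    (∀ (A : Subset N) → IsMaximal 𝒞 A → n ≤ ∣ A ∣) →
    (T F : Subset N) → ∣ T ∣ ≡ t → ∣ F ∣ ≡ s →
    s + t < n → k + s ≤ n →
    (n ∸ s ∸ k) ^ s * card (link (level k 𝒞) T)
      ≤ (n ∸ s ∸ t) ^ s * card (link₂ (level k 𝒞) T (F ∪ T))
lemma7 n _ k _ N _ _ _ _ 𝒞 closed large T F refl refl _ k+s≤n = bound
  where
  open Faces 𝒞 k T
  open ≤-Reasoning
  uˢ wˢ : ℕ
  uˢ = (n ∸ ∣ F ∣ ∸ k) ^ ∣ F ∣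
  wˢ = (n ∸ ∣ F ∣ ∸ ∣ T ∣) ^ ∣ F ∣
  bound : uˢ * card (link (level k 𝒞) T) ≤ wˢ * card (link₂ (level k 𝒞) T (F ∪ T))
  bound with ∣ T ∣ ≤? k
  ... | no ∣T∣≰k = begin
    uˢ * card (link (level k 𝒞) T)  ≤⟨ *-monoʳ-≤ uˢ card-link≤faces⊥ ⟩
    uˢ * faces ⊥                    ≡⟨ cong (uˢ *_) (faces≡0 (≰⇒> ∣T∣≰k)) ⟩
    uˢ * 0                          ≡⟨ *-zeroʳ uˢ ⟩
    0                               ≤⟨ z≤n ⟩
    wˢ * card (link₂ (level k 𝒞) T (F ∪ T)) ∎
  ... | yes ∣T∣≤k = begin
    uˢ * card (link (level k 𝒞) T)  ≤⟨ *-monoʳ-≤ uˢ card-link≤faces⊥ ⟩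
    uˢ * faces ⊥                    ≤⟨ faces-iterate closed large ∣T∣≤k k+s≤n ∣ F ∣ (∣p─q∣≤∣p∣ F T) ≤-refl
                                         (x∉p⇒x∈∁p ∘ x∈p─q⇒x∉q) ⟩
    wˢ * faces (F ─ T)              ≤⟨ *-monoʳ-≤ wˢ (faces≤card-link₂ F) ⟩
    wˢ * card (link₂ (level k 𝒞) T (F ∪ T)) ∎
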